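{- Let $a^2,b^2,c^2,d^2,e^2,f^2,g^2,h^2,i^2$ be a primitive magic square of squares (arranged with $a^2,b^2,c^2$ in the top row, $d^2,e^2,f^2$ in the middle row, $g^2,h^2,i^2$ in the bottom row). If a prime $p\equiv 1 \pmod 4$ divides both the central entry $e^2$ and a corner entry, then the residue class of the square mod $p$ is, up to scaling and rotation, \[ \begin{array}{c|c|c} 0 & 1 & -1\\ \hline -1 & 0 & 1\\ \hline 1 & -1 & 0 \end{array}. \]
   Context: A magic square of squares is a $3\times 3$ grid of $9$ distinct integer squares such that the entries of each row, each column and both main diagonals sum to the same total $T$ (necessarily $T=3e^2$). It is primitive if the greatest common divisor of all its entries is $1$. The residue class mod $p$ of the square is the $3\times3$ grid of the residues of its entries in $\mathbb{F}_p$. Scaling means multiplying every entry of the residue class by the same nonzero quadratic residue mod $p$; rotation means rotating the grid by a multiple of $90^\circ$. -}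

module Defs where

open import Data.Nat using (ℕ; zero; suc)
open import Data.Fin using (Fin; zero; suc; opposite)
open import Data.Integer using (ℤ; +_; _+_; _*_; -_; _-_)
open import Data.Integer.Divisibility using (_∣_)
open import Data.Product using (_×_; Σ; ∃; _,_)
open import Relation.Binary.PropositionalEquality using (_≡_; _≢_)
open import Data.Sum using (_⊎_)
open import Relation.Nullary using (¬_)

-- A 3×3 grid: rows and columns indexed by Fin 3 (row 0 = top, column 0 = left).
Grid : Set
Grid = Fin 3 → Fin 3 → ℤ

grid : (a b c d e f g h i : ℤ) → Grid
grid a b c d e f g h i zero zero = a
grid a b c d e f g h i zero (suc zero) = b
grid a b c d e f g h i zero (suc (suc zero)) = c
grid a b c d e f g h i (suc zero) zero = d
grid a b c d e f g h i (suc zero) (suc zero) = e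
grid a b c d e f g h i (suc zero) (suc (suc zero)) = f
grid a b c d e f g h i (suc (suc zero)) zero = g
grid a b c d e f g h i (suc (suc zero)) (suc zero) = h
grid a b c d e f g h i (suc (suc zero)) (suc (suc zero)) = i

squareGrid : (a b c d e f g h i : ℤ) → Grid
squareGrid a b c d e f g h i =
  grid (a * a) (b * b) (c * c) (d * d) (e * e) (f * f) (g * g) (h * h) (i * i)

Distinct : Grid → Set
Distinct M = ∀ r₁ c₁ r₂ c₂ → (r₁ ≡ r₂ → c₁ ≢ c₂) → M r₁ c₁ ≢ M r₂ c₂

IsMagicWith : Grid → ℤ → Set
IsMagicWith M T =
  (∀ r → M r zero + M r (suc zero) + M r (suc (suc zero)) ≡ T) ×
  (∀ c → M zero c + M (suc zero) c + M (suc (suc zero)) c ≡ T) ×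
  (M zero zero + M (suc zero) (suc zero) + M (suc (suc zero)) (suc (suc zero)) ≡ T) ×
  (M zero (suc (suc zero)) + M (suc zero) (suc zero) + M (suc (suc zero)) zero ≡ T)

IsMagic : Grid → Set
IsMagic M = Σ ℤ (IsMagicWith M)

IsMagicSquareOfSquares : (a b c d e f g h i : ℤ) → Set
IsMagicSquareOfSquares a b c d e f g h i =
  Distinct (squareGrid a b c d e f g h i) × IsMagic (squareGrid a b c d e f g h i)

Primitive : Grid → Set
Primitive M = ∀ (n : ℕ) → (∀ r c → (+ n) ∣ M r c) → n ≡ 1

-- Rotation by 90° (clockwise): new (r , c) entry is old (2 - c , r).
rot90 : Grid → Grid
rot90 M r c = M (opposite c) r

rotate : ℕ → Grid → Grid
rotate zero M = M
rotate (suc k) M = rot90 (rotate k M)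

_≡_[mod_] : ℤ → ℤ → ℕ → Set
x ≡ y [mod p ] = (+ p) ∣ (x - y)

targetPattern : Grid
targetPattern = grid (+ 0) (+ 1) (- (+ 1)) (- (+ 1)) (+ 0) (+ 1) (+ 1) (- (+ 1)) (+ 0)

ResidueUpToScalingRotation : ℕ → Grid → Grid → Set
ResidueUpToScalingRotation p M P =
  Σ ℕ λ k → Σ ℤ λ t → ¬ ((+ p) ∣ t) ×
    (∀ r c → M r c ≡ (t * t) * rotate k P r c [mod p ])

module Submission where

-- Lucas: a 3×3 magic square with centre E is E + x·P + y·P′, where P is the target pattern,
-- P′ its quarter turn, x = E − C and y = A − E; its corners are E + y, E − x, E + x, E − y.
-- If p divides E and a corner, then p divides x or y, so modulo p the square is a multiple of
-- P or P′, the multiplier being the entry B = b² or A = a² respectively. Primitivity forces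
-- p ∤ b (resp. p ∤ a).

open import Defs
open import Data.Nat using (ℕ; _%_; nonTrivial⇒≢1)
open import Data.Nat.Primality using (Prime; prime⇒nonTrivial)
open import Data.Integer using (ℤ; +_; _*_; _+_; -_; _-_)
open import Data.Integer.Divisibility using (_∣_)
open import Data.Integer.Divisibility.Signed using (∣ᵤ⇒∣; ∣⇒∣ᵤ; ∣m∣n⇒∣m+n; ∣m∣n⇒∣m-n; ∣m+n∣n⇒∣m; ∣m⇒∣-m; ∣m⇒∣m*n) renaming (_∣_ to _∣ₛ_)
open import Data.Integer.Tactic.RingSolver using (solve)
open import Data.Fin using (zero; suc)
open import Data.List using (List; _∷_; [])
open import Data.Product using (_,_)
open import Data.Sum using (_⊎_; inj₁; inj₂; [_,_]′)
open import Function.Base using (_∋_)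
open import Relation.Binary.PropositionalEquality using (_≡_; _≢_; refl; sym; trans; cong; cong₂; subst; module ≡-Reasoning)
open import Relation.Nullary using (¬_)

x+y+z≡t⇒y≡t-x-z : ∀ {x y z t : ℤ} → x + y + z ≡ t → y ≡ t - x - z
x+y+z≡t⇒y≡t-x-z {x} {y} {z} refl = solve (x ∷ y ∷ z ∷ [])

x+y+z≡t⇒z≡t-x-y : ∀ {x y z t : ℤ} → x + y + z ≡ t → z ≡ t - x - y
x+y+z≡t⇒z≡t-x-y {x} {y} {z} refl = solve (x ∷ y ∷ z ∷ [])

magic⇒E+E+E≡T : ∀ {A B C D E F G H I T} → IsMagicWith (grid A B C D E F G H I) T → E + E + E ≡ T
magic⇒E+E+E≡T {A} {B} {C} {D} {E} {F} {G} {H} {I} {T} (rows , cols , d₁ , d₂) = begin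
  E + E + E
    ≡⟨ solve (A ∷ B ∷ C ∷ E ∷ G ∷ H ∷ I ∷ []) ⟩
  (B + E + H) + (A + E + I) + (C + E + G) - (A + B + C) - (G + H + I)
    ≡⟨ cong₂ _-_ (cong₂ _-_ (cong₂ _+_ (cong₂ _+_ (cols (suc zero)) d₁) d₂) (rows zero)) (rows (suc (suc zero))) ⟩
  T + T + T - T - T
    ≡⟨ solve (T ∷ []) ⟩
  T ∎
  where open ≡-Reasoning

-- targetPattern and its quarter turn span the magic squares of total 0.
lucas : (e x y : ℤ) → Grid
lucas e x y r c = e + x * targetPattern r c + y * rotate 1 targetPattern r c

magic⇒lucas : ∀ {A B C D E F G H I T} → IsMagicWith (grid A B C D E F G H I) T →
              ∀ r c → grid A B C D E F G H I r c ≡ lucas E (E - C) (A - E) r c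
magic⇒lucas {A} {B} {C} {D} {E} {F} {G} {H} {I} magic@(rows , cols , d₁ , d₂) with magic⇒E+E+E≡T magic
... | refl = cell
  where
  vars : List ℤ
  vars = A ∷ C ∷ E ∷ []
  B≡ : B ≡ E + E + E - A - C
  B≡ = x+y+z≡t⇒y≡t-x-z (rows zero)
  G≡ : G ≡ E + E + E - C - E
  G≡ = x+y+z≡t⇒z≡t-x-y d₂
  I≡ : I ≡ E + E + E - A - E
  I≡ = x+y+z≡t⇒z≡t-x-y d₁
  -- The solver does not unfold grid or lucas, so each cell's Lucas form is spelled out.
  cell : ∀ r c → grid A B C D E F G H I r c ≡ lucas E (E - C) (A - E) r c
  cell zero zero = A ≡ E + (E - C) * + 0 + (A - E) * + 1 ∋ solve vars
  cell zero (suc zero) = B ≡ E + (E - C) * + 1 + (A - E) * - + 1 ∋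
    trans B≡ (solve vars)
  cell zero (suc (suc zero)) = C ≡ E + (E - C) * - + 1 + (A - E) * + 0 ∋ solve vars
  cell (suc zero) zero = D ≡ E + (E - C) * - + 1 + (A - E) * - + 1 ∋
    trans (x+y+z≡t⇒y≡t-x-z (cols zero))
          (trans (cong (λ g → E + E + E - A - g) G≡) (solve vars))
  cell (suc zero) (suc zero) = E ≡ E + (E - C) * + 0 + (A - E) * + 0 ∋ solve vars
  cell (suc zero) (suc (suc zero)) = F ≡ E + (E - C) * + 1 + (A - E) * + 1 ∋
    trans (x+y+z≡t⇒y≡t-x-z (cols (suc (suc zero))))
          (trans (cong (λ i → E + E + E - C - i) I≡) (solve vars))
  cell (suc (suc zero)) zero = G ≡ E + (E - C) * + 1 + (A - E) * + 0 ∋ trans G≡ (solve vars)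
  cell (suc (suc zero)) (suc zero) = H ≡ E + (E - C) * - + 1 + (A - E) * + 1 ∋
    trans (x+y+z≡t⇒z≡t-x-y (cols (suc zero)))
          (trans (cong (λ b → E + E + E - b - E) B≡) (solve vars))
  cell (suc (suc zero)) (suc (suc zero)) = I ≡ E + (E - C) * + 0 + (A - E) * - + 1 ∋ trans I≡ (solve vars)

module LucasFormModulo (p : ℕ) {M : Grid} (e x y : ℤ)
                       (M≗lucas : ∀ r c → M r c ≡ lucas e x y r c) (p∣e : + p ∣ e) where

  private
    p∣ₛe : + p ∣ₛ e
    p∣ₛe = ∣ᵤ⇒∣ {+ p} {e} p∣e

    p∣ₛlucas : ∀ r c → + p ∣ M r c → + p ∣ₛ lucas e x y r c
    p∣ₛlucas r c p∣M = ∣ᵤ⇒∣ {+ p} {lucas e x y r c} (subst (+ p ∣_) (M≗lucas r c) p∣M)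

  ∣y⇒≡targetPattern : + p ∣ y → ∀ r c → M r c ≡ M zero (suc zero) * targetPattern r c [mod p ]
  ∣y⇒≡targetPattern p∣y r c rewrite M≗lucas r c | M≗lucas zero (suc zero) =
    ∣⇒∣ᵤ (subst (+ p ∣ₛ_) (sym (split (targetPattern r c) (rotate 1 targetPattern r c)))
      (∣m∣n⇒∣m+n (∣m⇒∣m*n _ p∣ₛe) (∣m⇒∣m*n _ (∣ᵤ⇒∣ {+ p} {y} p∣y))))
    where
    split : ∀ u v → (e + x * u + y * v) - (e + x * + 1 + y * - + 1) * u ≡ e * (+ 1 - u) + y * (v + u)
    split u v = solve (e ∷ x ∷ y ∷ u ∷ v ∷ [])

  ∣x⇒≡rotatedTargetPattern : + p ∣ x → ∀ r c → M r c ≡ M zero zero * rotate 1 targetPattern r c [mod p ]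
  ∣x⇒≡rotatedTargetPattern p∣x r c rewrite M≗lucas r c | M≗lucas zero zero =
    ∣⇒∣ᵤ (subst (+ p ∣ₛ_) (sym (split (targetPattern r c) (rotate 1 targetPattern r c)))
      (∣m∣n⇒∣m+n (∣m⇒∣m*n _ p∣ₛe) (∣m⇒∣m*n _ (∣ᵤ⇒∣ {+ p} {x} p∣x))))
    where
    split : ∀ u v → (e + x * u + y * v) - (e + x * + 0 + y * + 1) * v ≡ e * (+ 1 - v) + x * u
    split u v = solve (e ∷ x ∷ y ∷ u ∷ v ∷ [])

  ∣corner⇒∣y⊎∣x :
    + p ∣ M zero zero ⊎ + p ∣ M zero (suc (suc zero)) ⊎
    + p ∣ M (suc (suc zero)) zero ⊎ + p ∣ M (suc (suc zero)) (suc (suc zero)) →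
    + p ∣ y ⊎ + p ∣ x
  ∣corner⇒∣y⊎∣x (inj₁ p∣M₀₀) =
    inj₁ (∣⇒∣ᵤ (subst (+ p ∣ₛ_) (sym y≡) (∣m∣n⇒∣m-n (p∣ₛlucas zero zero p∣M₀₀) p∣ₛe)))
    where y≡ : y ≡ (e + x * + 0 + y * + 1) - e
          y≡ = solve (e ∷ x ∷ y ∷ [])
  ∣corner⇒∣y⊎∣x (inj₂ (inj₁ p∣M₀₂)) =
    inj₂ (∣⇒∣ᵤ (subst (+ p ∣ₛ_) (sym x≡) (∣m∣n⇒∣m-n p∣ₛe (p∣ₛlucas zero (suc (suc zero)) p∣M₀₂))))
    where x≡ : x ≡ e - (e + x * - + 1 + y * + 0)
          x≡ = solve (e ∷ x ∷ y ∷ [])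
  ∣corner⇒∣y⊎∣x (inj₂ (inj₂ (inj₁ p∣M₂₀))) =
    inj₂ (∣⇒∣ᵤ (subst (+ p ∣ₛ_) (sym x≡) (∣m∣n⇒∣m-n (p∣ₛlucas (suc (suc zero)) zero p∣M₂₀) p∣ₛe)))
    where x≡ : x ≡ (e + x * + 1 + y * + 0) - e
          x≡ = solve (e ∷ x ∷ y ∷ [])
  ∣corner⇒∣y⊎∣x (inj₂ (inj₂ (inj₂ p∣M₂₂))) =
    inj₁ (∣⇒∣ᵤ (subst (+ p ∣ₛ_) (sym y≡)
                 (∣m∣n⇒∣m-n p∣ₛe (p∣ₛlucas (suc (suc zero)) (suc (suc zero)) p∣M₂₂))))
    where y≡ : y ≡ e - (e + x * + 0 + y * - + 1)
          y≡ = solve (e ∷ x ∷ y ∷ [])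

primitive⇒residueUpToScalingRotation : ∀ {M P : Grid} {p} k t → Primitive M → p ≢ 1 →
  (∀ r c → M r c ≡ (t * t) * rotate k P r c [mod p ]) → ResidueUpToScalingRotation p M P
primitive⇒residueUpToScalingRotation {M} {P} {p} k t prim p≢1 M≡ = k , t , p∤t , M≡
  where
  p∤t : ¬ (+ p ∣ t)
  p∤t p∣t = p≢1 (prim p λ r c → ∣⇒∣ᵤ (∣m+n∣n⇒∣m {m = M r c}
    (∣ᵤ⇒∣ {+ p} {M r c - (t * t) * rotate k P r c} (M≡ r c))
    (∣m⇒∣-m (∣m⇒∣m*n (rotate k P r c) (∣m⇒∣m*n t (∣ᵤ⇒∣ {+ p} {t} p∣t))))))

corollary4p1 : (a b c d e f g h i : ℤ) (p : ℕ) →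
    IsMagicSquareOfSquares a b c d e f g h i →
    Primitive (squareGrid a b c d e f g h i) →
    Prime p → p % 4 ≡ 1 →
    (+ p) ∣ (e * e) →
    ((+ p) ∣ (a * a) ⊎ (+ p) ∣ (c * c) ⊎ (+ p) ∣ (g * g) ⊎ (+ p) ∣ (i * i)) →
    ResidueUpToScalingRotation p (squareGrid a b c d e f g h i) targetPattern
corollary4p1 a b c d e f g h i p (_ , _ , magic) prim p-prime _ p∣E p∣corner =
  [ (λ p∣y → residue 0 b (∣y⇒≡targetPattern p∣y))
  , (λ p∣x → residue 1 a (∣x⇒≡rotatedTargetPattern p∣x))
  ]′ (∣corner⇒∣y⊎∣x p∣corner)
  where
  M : Grid
  M = squareGrid a b c d e f g h i

  M≗lucas : ∀ row col → M row col ≡ lucas (e * e) (e * e - c * c) (a * a - e * e) row col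
  M≗lucas = magic⇒lucas magic

  open LucasFormModulo p (e * e) (e * e - c * c) (a * a - e * e) M≗lucas p∣E

  residue : ∀ k t → (∀ row col → M row col ≡ (t * t) * rotate k targetPattern row col [mod p ]) →
            ResidueUpToScalingRotation p M targetPattern
  residue k t = primitive⇒residueUpToScalingRotation {M} {targetPattern} k t prim
                  (nonTrivial⇒≢1 {{prime⇒nonTrivial p-prime}})
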